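{- Let $n\ge3$ and $D_n=\langle a,b\mid a^n=b^2=1,\ ab=ba^{ -1}\rangle$. Then $\Gamma(D_n)$ is a split graph if and only if $n$ is an odd prime.
   Context: For a group $G$, $\Gamma(G)$ is the simple graph whose vertices are the subgroups of $G$ other than $\{1\}$ and $G$, two distinct vertices $H,K$ being adjacent iff $HK=KH$. A split graph is a graph whose vertex set can be partitioned into a clique and an independent set. -}

module Defs where

open import Data.Nat using (ℕ; _+_; _∸_; NonZero)
open import Data.Nat.DivMod using (_mod_)
open import Data.Fin using (Fin; toℕ)
open import Data.Bool using (Bool; true; false; T; if_then_else_; _xor_)
open import Data.Vec using (Vec; lookup; replicate; tabulate)
open import Data.Product using (_×_; _,_; Σ; ∃)
open import Relation.Binary.PropositionalEquality using (_≡_; _≢_)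
open import Relation.Nullary using (¬_)
open import Data.Nat using (_≡ᵇ_)

-- Concrete model of the dihedral group D_n = ⟨a,b | a^n = b^2 = 1, ab = ba⁻¹⟩ :
-- the element (i , r) stands for a^i b^r  (r = false : a^i, r = true : a^i b).
module Dihedral (n : ℕ) .{{_ : NonZero n}} where

  Elem : Set
  Elem = Fin n × Bool

  -- (a^i b^r)(a^j b^s) = a^(i + (-1)^r j) b^(r xor s)
  _·_ : Elem → Elem → Elem
  (i , r) · (j , s) =
    ((toℕ i + (if r then n ∸ toℕ j else toℕ j)) mod n , r xor s)

  e : Elem
  e = (0 mod n , false)

  inv : Elem → Elem
  inv (i , false) = ((n ∸ toℕ i) mod n , false)
  inv (i , true)  = (i , true)

  -- Subsets of D_n: membership of rotations a^i and of reflections a^i b.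
  Sub : Set
  Sub = Vec Bool n × Vec Bool n

  _∈_ : Elem → Sub → Set
  (i , false) ∈ (R , F) = T (lookup R i)
  (i , true)  ∈ (R , F) = T (lookup F i)

  record IsSubgroup (S : Sub) : Set where
    field
      has-e   : e ∈ S
      closed· : ∀ x y → x ∈ S → y ∈ S → (x · y) ∈ S
      closed⁻ : ∀ x → x ∈ S → inv x ∈ S

  trivialSub : Sub
  trivialSub = (tabulate (λ i → toℕ i ≡ᵇ 0) , replicate n false)

  fullSub : Sub
  fullSub = (replicate n true , replicate n true)

  Vertex : Sub → Set
  Vertex S = IsSubgroup S × S ≢ trivialSub × S ≢ fullSub

  ProdSub : Sub → Sub → Set
  ProdSub H K = ∀ h k → h ∈ H → k ∈ K →
    Σ Elem λ k' → Σ Elem λ h' → k' ∈ K × h' ∈ H × (h · k) ≡ (k' · h')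

  Permute : Sub → Sub → Set
  Permute H K = ProdSub H K × ProdSub K H

  IsSplitΓ : Set
  IsSplitΓ = ∃ λ (c : Sub → Bool) → ∀ H K → Vertex H → Vertex K → H ≢ K →
    (c H ≡ true → c K ≡ true → Permute H K) ×
    (c H ≡ false → c K ≡ false → ¬ Permute H K)

module Submission where

-- Split ⇒ odd prime: a divisor 3 ≤ d < n gives the induced 2K₂
-- S d 0 ⊇ S n 0, S d 1 ⊇ S n 1 (b · ab = a⁻¹ lies in no product of the
-- opposite pairs), and for n = 4 the subgroups {1,b}, {1,a²b}, {1,ab}, {1,a³b}
-- form one.  Odd prime ⇒ split: the subgroups without reflections commute (a
-- clique); a proper subgroup containing a^i b is {1 , a^i b}, since for n prime
-- any rotation a^x ≠ 1 generates all rotations; and for n odd distinct such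
-- subgroups do not permute (an independent set).

open import Defs
open import Data.Nat using (ℕ; zero; suc; _+_; _*_; _∸_; _≤_; _<_; NonZero; z≤n; s≤s; _≡ᵇ_; ≢-nonZero; ≢-nonZero⁻¹; >-nonZero; >-nonZero⁻¹; nonTrivial⇒n>1; n>1⇒nonTrivial)
open import Data.Nat.Properties
open import Data.Nat.DivMod
open import Data.Nat.Divisibility using (_∣_; divides; n∣m⇒m%n≡0; ∣-refl; ∣⇒≤)
open import Data.Nat.Primality using (Prime; prime; Composite)
open import Data.Nat.Divisibility.Core using (hasNonTrivialDivisor)
open import Data.Nat.GCD using (module Bézout)
open import Data.Nat.Coprimality using (Coprime; coprime-Bézout; prime⇒coprime)
open import Data.Fin using (Fin; toℕ; #_)
open import Data.Fin.Properties using (toℕ-injective; toℕ-fromℕ<; toℕ<n; any?)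
open import Data.Bool using (Bool; true; false; T; not)
open import Data.Bool.Properties using (T?)
open import Data.Vec using (Vec; lookup; tabulate)
open import Data.Vec.Properties using (lookup∘tabulate; tabulate∘lookup; tabulate-cong; lookup-replicate)
open import Data.Product using (_×_; _,_; Σ; ∃; proj₁; proj₂)
open import Data.Sum using (_⊎_; inj₁; inj₂)
open import Data.Empty using (⊥; ⊥-elim)
open import Data.Unit using (tt)
open import Function using (_∘_)
open import Function.Bundles using (_⇔_; mk⇔)
open import Relation.Nullary using (¬_; Dec; yes; no; does; contradiction)
open import Relation.Binary using (tri<; tri≈; tri>)
open import Relation.Binary.PropositionalEquality
open ≡-Reasoning

module SplitGraphs {A : Set} (IsVertex : A → Set) (Adj : A → A → Set) where

  IsSplitColouring : (A → Bool) → Set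
  IsSplitColouring c = ∀ x y → IsVertex x → IsVertex y → x ≢ y →
    (c x ≡ true → c y ≡ true → Adj x y) × (c x ≡ false → c y ≡ false → ¬ Adj x y)

  Edge NonEdge : A → A → Set
  Edge u v = u ≢ v × Adj u v
  NonEdge u v = u ≢ v × ¬ Adj u v

  record Induced2K₂ : Set where
    field
      x₁ y₁ x₂ y₂ : A
      x₁-vertex : IsVertex x₁
      y₁-vertex : IsVertex y₁
      x₂-vertex : IsVertex x₂
      y₂-vertex : IsVertex y₂
      edge₁ : Edge x₁ y₁
      edge₂ : Edge x₂ y₂
      x₁x₂ : NonEdge x₁ x₂
      x₁y₂ : NonEdge x₁ y₂
      y₁x₂ : NonEdge y₁ x₂
      y₁y₂ : NonEdge y₁ y₂

  split⇒2K₂-free : ∀ {c} → IsSplitColouring c → ¬ Induced2K₂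
  split⇒2K₂-free {c} split g = noCliqueEdge (cliqueEnd x₁-vertex y₁-vertex edge₁) (cliqueEnd x₂-vertex y₂-vertex edge₂)
    where
    open Induced2K₂ g

    cliqueEnd : ∀ {x y} → IsVertex x → IsVertex y → Edge x y → c x ≡ true ⊎ c y ≡ true
    cliqueEnd {x} {y} vx vy (x≢y , xy) with c x in cx | c y in cy
    ... | true  | _     = inj₁ refl
    ... | false | true  = inj₂ refl
    ... | false | false = ⊥-elim (proj₂ (split x y vx vy x≢y) cx cy xy)

    notBothClique : ∀ {u v} → IsVertex u → IsVertex v → NonEdge u v → c u ≡ true → c v ≡ true → ⊥
    notBothClique {u} {v} vu vv (u≢v , ¬uv) cu cv = ¬uv (proj₁ (split u v vu vv u≢v) cu cv)

    noCliqueEdge : c x₁ ≡ true ⊎ c y₁ ≡ true → c x₂ ≡ true ⊎ c y₂ ≡ true → ⊥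
    noCliqueEdge (inj₁ p) (inj₁ q) = notBothClique x₁-vertex x₂-vertex x₁x₂ p q
    noCliqueEdge (inj₁ p) (inj₂ q) = notBothClique x₁-vertex y₂-vertex x₁y₂ p q
    noCliqueEdge (inj₂ p) (inj₁ q) = notBothClique y₁-vertex x₂-vertex y₁x₂ p q
    noCliqueEdge (inj₂ p) (inj₂ q) = notBothClique y₁-vertex y₂-vertex y₁y₂ p q

0%≡0 : ∀ d .{{_ : NonZero d}} → 0 % d ≡ 0
0%≡0 d = m<n⇒m%n≡m (>-nonZero⁻¹ d)

+-cong-% : ∀ d .{{_ : NonZero d}} {a b a' b'} → a % d ≡ a' % d → b % d ≡ b' % d → (a + b) % d ≡ (a' + b') % d
+-cong-% d {a} {b} {a'} {b'} p q = begin
  (a + b) % d                ≡⟨ %-distribˡ-+ a b d ⟩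
  (a % d + b % d) % d        ≡⟨ cong₂ (λ u v → (u + v) % d) p q ⟩
  (a' % d + b' % d) % d      ≡⟨ %-distribˡ-+ a' b' d ⟨
  (a' + b') % d              ∎

oddPrime-criterion : ∀ n → 3 ≤ n → n ≢ 4 → (∀ d → d ∣ n → 3 ≤ d → d < n → ⊥) → Prime n × ¬ 2 ∣ n
oddPrime-criterion n 3≤n n≢4 noDivisor = prime {{n>1⇒nonTrivial 1<n}} notComposite , notEven
  where
  1<n : 1 < n
  1<n = ≤-trans (s≤s (s≤s z≤n)) 3≤n

  -- n = 2m: m ≤ 1 is too small, m = 2 is excluded, and m ≥ 3 is a forbidden divisor
  notEven : ¬ 2 ∣ n
  notEven (divides m n≡2m) with m
  ... | 0 = <-irrefl refl (<-≤-trans (s≤s z≤n) (subst (3 ≤_) n≡2m 3≤n))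
  ... | 1 = <-irrefl refl (<-≤-trans (s≤s (s≤s (s≤s z≤n))) (subst (3 ≤_) n≡2m 3≤n))
  ... | 2 = n≢4 n≡2m
  ... | suc (suc (suc k)) = noDivisor (3 + k) (divides 2 (trans n≡2m (*-comm (3 + k) 2)))
          (s≤s (s≤s (s≤s z≤n))) (subst (3 + k <_) (sym n≡2m) (m<m*n (3 + k) 2 (s≤s (s≤s z≤n))))

  notComposite : ¬ Composite n
  notComposite (hasNonTrivialDivisor {d} d<n d∣n) with m≤n⇒m<n∨m≡n (nonTrivial⇒n>1 d)
  ... | inj₁ 2<d  = noDivisor d d∣n 2<d d<n
  ... | inj₂ refl = notEven d∣n

T-ext : ∀ {a b : Bool} → (T a → T b) → (T b → T a) → a ≡ b
T-ext {false} {false} f g = refl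
T-ext {false} {true}  f g = ⊥-elim (g tt)
T-ext {true}  {false} f g = ⊥-elim (f tt)
T-ext {true}  {true}  f g = refl

lookup-ext : ∀ {k} {v w : Vec Bool k} → (∀ i → lookup v i ≡ lookup w i) → v ≡ w
lookup-ext {v = v} {w} p = trans (sym (tabulate∘lookup v)) (trans (tabulate-cong p) (tabulate∘lookup w))

tabulate-≡ᵇ⁻ : ∀ {k} (f : Fin k → ℕ) m x → T (lookup (tabulate (λ y → f y ≡ᵇ m)) x) → f x ≡ m
tabulate-≡ᵇ⁻ f m x p = ≡ᵇ⇒≡ _ _ (subst T (lookup∘tabulate _ x) p)

tabulate-≡ᵇ⁺ : ∀ {k} (f : Fin k → ℕ) m x → f x ≡ m → T (lookup (tabulate (λ y → f y ≡ᵇ m)) x)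
tabulate-≡ᵇ⁺ f m x p = subst T (sym (lookup∘tabulate _ x)) (≡⇒≡ᵇ _ _ p)

module DihedralFacts (n : ℕ) .{{_ : NonZero n}} where
  open Dihedral n

  toℕ-mod : ∀ m → toℕ (m mod n) ≡ m % n
  toℕ-mod m = toℕ-fromℕ< _

  toℕ%n : (x : Fin n) → toℕ x % n ≡ toℕ x
  toℕ%n x = m<n⇒m%n≡m (toℕ<n x)

  mod-≡ : ∀ {m} {x : Fin n} → m % n ≡ toℕ x → m mod n ≡ x
  mod-≡ p = toℕ-injective (trans (toℕ-mod _) p)

  toℕ-e : toℕ (proj₁ e) ≡ 0
  toℕ-e = trans (toℕ-mod 0) (0%≡0 n)

  index-≡ : ∀ {x y : Elem} → x ≡ y → toℕ (proj₁ x) ≡ toℕ (proj₁ y)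
  index-≡ = cong (toℕ ∘ proj₁)

  kind-≢ : ∀ {i j : Fin n} → (i , false) ≢ (j , true)
  kind-≢ ()

  e·x : ∀ x → e · x ≡ x
  e·x (c , s) = cong (_, s) (mod-≡ (trans (cong (λ u → (u + toℕ c) % n) toℕ-e) (toℕ%n c)))

  x·e : ∀ x → x · e ≡ x
  x·e (a , false) = cong (_, false) (mod-≡ (begin
    (toℕ a + toℕ (proj₁ e)) % n ≡⟨ cong (λ u → (toℕ a + u) % n) toℕ-e ⟩
    (toℕ a + 0) % n            ≡⟨ cong (_% n) (+-identityʳ (toℕ a)) ⟩
    toℕ a % n                  ≡⟨ toℕ%n a ⟩
    toℕ a                      ∎))
  x·e (a , true) = cong (_, true) (mod-≡ (begin
    (toℕ a + (n ∸ toℕ (proj₁ e))) % n ≡⟨ cong (λ u → (toℕ a + (n ∸ u)) % n) toℕ-e ⟩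
    (toℕ a + n) % n                  ≡⟨ [m+n]%n≡m%n (toℕ a) n ⟩
    toℕ a % n                        ≡⟨ toℕ%n a ⟩
    toℕ a                            ∎))

  -- The rotation index of a^(i - j); note a^i b · a^j b = a^(i - j).
  δ : ℕ → ℕ → ℕ
  δ i j = (i + (n ∸ j)) % n

  δ-+ : ∀ i {j} → j ≤ n → (δ i j + j) % n ≡ i % n
  δ-+ i {j} j≤n = begin
    ((i + (n ∸ j)) % n + j) % n ≡⟨ +-cong-% n (m%n%n≡m%n (i + (n ∸ j)) n) refl ⟩
    (i + (n ∸ j) + j) % n       ≡⟨ cong (_% n) (+-assoc i (n ∸ j) j) ⟩
    (i + (n ∸ j + j)) % n       ≡⟨ cong (λ u → (i + u) % n) (m∸n+n≡m j≤n) ⟩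
    (i + n) % n                 ≡⟨ [m+n]%n≡m%n i n ⟩
    i % n                       ∎

  δ≡0⇒≡ : ∀ {i j} → i < n → j < n → δ i j ≡ 0 → i ≡ j
  δ≡0⇒≡ {i} {j} i<n j<n δ≡0 = begin
    i                ≡⟨ m<n⇒m%n≡m i<n ⟨
    i % n            ≡⟨ δ-+ i (<⇒≤ j<n) ⟨
    (δ i j + j) % n  ≡⟨ cong (λ u → (u + j) % n) δ≡0 ⟩
    j % n            ≡⟨ m<n⇒m%n≡m j<n ⟩
    j                ∎

  δ-≥ : ∀ {i j} → j ≤ i → i < n → δ i j ≡ i ∸ j
  δ-≥ {i} {j} j≤i i<n = begin
    (i + (n ∸ j)) % n           ≡⟨ cong (λ u → (u + (n ∸ j)) % n) (m∸n+n≡m j≤i) ⟨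
    ((i ∸ j) + j + (n ∸ j)) % n ≡⟨ cong (_% n) (+-assoc (i ∸ j) j (n ∸ j)) ⟩
    ((i ∸ j) + (j + (n ∸ j))) % n ≡⟨ cong (λ u → (i ∸ j + u) % n) (m+[n∸m]≡n (≤-trans j≤i (<⇒≤ i<n))) ⟩
    ((i ∸ j) + n) % n           ≡⟨ [m+n]%n≡m%n (i ∸ j) n ⟩
    (i ∸ j) % n                 ≡⟨ m<n⇒m%n≡m (≤-<-trans (m∸n≤m i j) i<n) ⟩
    i ∸ j                       ∎

  δ-< : ∀ {i j} → i < j → j ≤ n → δ i j ≡ i + (n ∸ j)
  δ-< {i} {j} i<j j≤n = m<n⇒m%n≡m (<-≤-trans (+-monoˡ-< (n ∸ j) i<j) (≤-reflexive (m+[n∸m]≡n j≤n)))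

  δ-sym⇒even : ∀ {i j} → j < i → i < n → δ i j ≡ δ j i → 2 ∣ n
  δ-sym⇒even {i} {j} j<i i<n δ-sym = divides k (begin
    n                ≡⟨ m+[n∸m]≡n (<⇒≤ i<n) ⟨
    i + (n ∸ i)      ≡⟨ cong (_+ (n ∸ i)) (m∸n+n≡m (<⇒≤ j<i)) ⟨
    k + j + (n ∸ i)  ≡⟨ +-assoc k j (n ∸ i) ⟩
    k + (j + (n ∸ i)) ≡⟨ cong (k +_) k≡j-i ⟨
    k + k            ≡⟨ cong (k +_) (+-identityʳ k) ⟨
    2 * k            ≡⟨ *-comm 2 k ⟩
    k * 2            ∎)
    where
    k = i ∸ j
    k≡j-i : k ≡ j + (n ∸ i)
    k≡j-i = trans (sym (δ-≥ (<⇒≤ j<i) i<n)) (trans δ-sym (δ-< j<i (<⇒≤ i<n)))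

  δ-sym⇒≡ : ¬ 2 ∣ n → ∀ {i j} → i < n → j < n → δ i j ≡ δ j i → i ≡ j
  δ-sym⇒≡ odd {i} {j} i<n j<n δ-sym with <-cmp i j
  ... | tri≈ _ i≡j _ = i≡j
  ... | tri< i<j _ _ = contradiction (δ-sym⇒even i<j j<n (sym δ-sym)) odd
  ... | tri> _ _ j<i = contradiction (δ-sym⇒even j<i i<n δ-sym) odd

  index-ref·ref : ∀ i j → toℕ (proj₁ ((i , true) · (j , true))) ≡ δ (toℕ i) (toℕ j)
  index-ref·ref i j = toℕ-mod _

  _⊆_ : Sub → Sub → Set
  H ⊆ K = ∀ x → x ∈ H → x ∈ K

  ⊆-antisym : ∀ {H K} → H ⊆ K → K ⊆ H → H ≡ K
  ⊆-antisym {R , F} {R' , F'} H⊆K K⊆H = cong₂ _,_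
    (lookup-ext λ i → T-ext (H⊆K (i , false)) (K⊆H (i , false)))
    (lookup-ext λ i → T-ext (H⊆K (i , true)) (K⊆H (i , true)))

  separated : ∀ {H K} x → x ∈ H → ¬ x ∈ K → H ≢ K
  separated x x∈H x∉K refl = x∉K x∈H

  ∈full : ∀ x → x ∈ fullSub
  ∈full (y , false) = subst T (sym (lookup-replicate y true)) tt
  ∈full (y , true)  = subst T (sym (lookup-replicate y true)) tt

  ref∉trivial : ∀ y → ¬ (y , true) ∈ trivialSub
  ref∉trivial y = subst T (lookup-replicate y false)

  -- if K ⊆ H then HK = H = KH
  ⊆⇒Permute : ∀ {H K} → IsSubgroup H → IsSubgroup K → K ⊆ H → Permute H K
  ⊆⇒Permute {H} {K} sH sK K⊆H = HK⊆KH , KH⊆HK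
    where
    open IsSubgroup
    HK⊆KH : ProdSub H K
    HK⊆KH h k h∈ k∈ = e , h · k , has-e sK , closed· sH h k h∈ (K⊆H k k∈) , sym (e·x (h · k))
    KH⊆HK : ProdSub K H
    KH⊆HK k h k∈ h∈ = k · h , e , closed· sH k h (K⊆H k k∈) h∈ , has-e sK , sym (x·e (k · h))

  commute⇒Permute : ∀ {H K} → (∀ h k → h ∈ H → k ∈ K → h · k ≡ k · h) → Permute H K
  commute⇒Permute c = (λ h k h∈ k∈ → k , h , k∈ , h∈ , c h k h∈ k∈)
                    , (λ k h k∈ h∈ → h , k , h∈ , k∈ , sym (c h k h∈ k∈))

  NoReflection : Sub → Set
  NoReflection H = ∀ x → ¬ (x , true) ∈ H

  rotations-Permute : ∀ {H K} → NoReflection H → NoReflection K → Permute H K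
  rotations-Permute {H} {K} noH noK = commute⇒Permute commute
    where
    commute : ∀ h k → h ∈ H → k ∈ K → h · k ≡ k · h
    commute (a , false) (c , false) _ _ = cong (λ m → m mod n , false) (+-comm (toℕ a) (toℕ c))
    commute (a , true)  _           a∈ _ = ⊥-elim (noH a a∈)
    commute (a , false) (c , true)  _ c∈ = ⊥-elim (noK c c∈)

  -- The subsets S d i = ⟨a^d , a^i b⟩ = { a^x : x ≡ 0 } ∪ { a^x b : x ≡ i }  (mod d).

  S : (d : ℕ) .{{_ : NonZero d}} → ℕ → Sub
  S d i = tabulate (λ x → toℕ x % d ≡ᵇ 0) , tabulate (λ x → toℕ x % d ≡ᵇ i % d)

  module _ (d : ℕ) .{{_ : NonZero d}} (i : ℕ) where
    rot∈S⁻ : ∀ x → (x , false) ∈ S d i → toℕ x % d ≡ 0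
    rot∈S⁻ = tabulate-≡ᵇ⁻ (λ x → toℕ x % d) 0
    rot∈S⁺ : ∀ x → toℕ x % d ≡ 0 → (x , false) ∈ S d i
    rot∈S⁺ = tabulate-≡ᵇ⁺ (λ x → toℕ x % d) 0
    ref∈S⁻ : ∀ x → (x , true) ∈ S d i → toℕ x % d ≡ i % d
    ref∈S⁻ = tabulate-≡ᵇ⁻ (λ x → toℕ x % d) (i % d)
    ref∈S⁺ : ∀ x → toℕ x % d ≡ i % d → (x , true) ∈ S d i
    ref∈S⁺ = tabulate-≡ᵇ⁺ (λ x → toℕ x % d) (i % d)

  b∈S : ∀ d .{{_ : NonZero d}} → (proj₁ e , true) ∈ S d 0
  b∈S d = ref∈S⁺ d 0 _ (cong (_% d) toℕ-e)

  -- Facts about S d i that need d ∣ n, so that indices mod n are well defined mod d.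
  module Divisor (d : ℕ) .{{_ : NonZero d}} (d∣n : d ∣ n) where

    toℕ-mod-% : ∀ m → toℕ (m mod n) % d ≡ m % d
    toℕ-mod-% m = trans (cong (_% d) (toℕ-mod m)) (m∣n⇒o%n%m≡o%m d n m d∣n)

    -- a - c ≡ 0 (mod d) when a ≡ c, computed as a + (n - c) since d ∣ n
    ∸-cancel : ∀ a c → c ≤ n → a % d ≡ c % d → (a + (n ∸ c)) % d ≡ 0
    ∸-cancel a c c≤n a≡c = begin
      (a + (n ∸ c)) % d ≡⟨ +-cong-% d a≡c refl ⟩
      (c + (n ∸ c)) % d ≡⟨ cong (_% d) (m+[n∸m]≡n c≤n) ⟩
      n % d             ≡⟨ n∣m⇒m%n≡0 n d d∣n ⟩
      0                 ∎

    neg-%0 : ∀ (x : Fin n) → toℕ x % d ≡ 0 → (n ∸ toℕ x) % d ≡ 0 % d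
    neg-%0 x x≡0 = trans (∸-cancel 0 (toℕ x) (<⇒≤ (toℕ<n x)) (trans (0%≡0 d) (sym x≡0))) (sym (0%≡0 d))

    S-subgroup : ∀ i → IsSubgroup (S d i)
    S-subgroup i = record
      { has-e = rot∈S⁺ d i _ (trans (toℕ-mod-% 0) (0%≡0 d))
      ; closed· = closed
      ; closed⁻ = inverse }
      where
      rot : ∀ x → (x , false) ∈ S d i → toℕ x % d ≡ 0 % d
      rot x p = trans (rot∈S⁻ d i x p) (sym (0%≡0 d))
      closed : ∀ x y → x ∈ S d i → y ∈ S d i → (x · y) ∈ S d i
      closed (a , false) (c , false) p q = rot∈S⁺ d i _
        (trans (toℕ-mod-% _) (trans (+-cong-% d (rot a p) (rot c q)) (0%≡0 d)))
      closed (a , false) (c , true) p q = ref∈S⁺ d i _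
        (trans (toℕ-mod-% _) (+-cong-% d (rot a p) (ref∈S⁻ d i c q)))
      closed (a , true) (c , false) p q = ref∈S⁺ d i _
        (trans (toℕ-mod-% _) (trans (+-cong-% d (ref∈S⁻ d i a p) (neg-%0 c (rot∈S⁻ d i c q))) (cong (_% d) (+-identityʳ i))))
      closed (a , true) (c , true) p q = rot∈S⁺ d i _
        (trans (toℕ-mod-% _) (∸-cancel (toℕ a) (toℕ c) (<⇒≤ (toℕ<n c)) (trans (ref∈S⁻ d i a p) (sym (ref∈S⁻ d i c q)))))
      inverse : ∀ x → x ∈ S d i → inv x ∈ S d i
      inverse (a , false) p = rot∈S⁺ d i _ (trans (toℕ-mod-% _) (trans (neg-%0 a (rot∈S⁻ d i a p)) (0%≡0 d)))
      inverse (a , true)  p = p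

    -- a^i b ∈ S d i, and a ∉ S d i when d ≥ 2
    S-vertex : 2 ≤ d → ∀ i → Vertex (S d i)
    S-vertex 2≤d i = S-subgroup i
      , separated (i mod n , true) (ref∈S⁺ d i _ (toℕ-mod-% i)) (ref∉trivial _)
      , (λ S≡full → separated (1 mod n , false) (∈full (1 mod n , false)) a∉S (sym S≡full))
      where
      a∉S : ¬ (1 mod n , false) ∈ S d i
      a∉S p = 0≢1+n (trans (sym (rot∈S⁻ d i _ p)) (trans (toℕ-mod-% 1) (m<n⇒m%n≡m 2≤d)))

    S-n⊆S-d : ∀ i → S n i ⊆ S d i
    S-n⊆S-d i (a , false) p = rot∈S⁺ d i a (begin
      toℕ a % d     ≡⟨ m∣n⇒o%n%m≡o%m d n (toℕ a) d∣n ⟨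
      toℕ a % n % d ≡⟨ cong (_% d) (rot∈S⁻ n i a p) ⟩
      0 % d         ≡⟨ 0%≡0 d ⟩
      0             ∎)
    S-n⊆S-d i (a , true) p = ref∈S⁺ d i a (begin
      toℕ a % d     ≡⟨ m∣n⇒o%n%m≡o%m d n (toℕ a) d∣n ⟨
      toℕ a % n % d ≡⟨ cong (_% d) (ref∈S⁻ n i a p) ⟩
      i % n % d     ≡⟨ m∣n⇒o%n%m≡o%m d n i d∣n ⟩
      i % d         ∎)

    ab∈S : (1 mod n , true) ∈ S d 1
    ab∈S = ref∈S⁺ d 1 _ (toℕ-mod-% 1)

    index-b·ab : 1 < n → toℕ (proj₁ ((proj₁ e , true) · (1 mod n , true))) % d ≡ (n ∸ 1) % d
    index-b·ab 1<n = trans (toℕ-mod-% _) (cong₂ (λ u v → (u + (n ∸ v)) % d) toℕ-e (trans (toℕ-mod 1) (m<n⇒m%n≡m 1<n)))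

    -- n - 1 ≡ c (mod d) would make d divide c + 1 < d
    n-1≢ : 1 < n → ∀ c → suc c < d → (n ∸ 1) % d ≢ c % d
    n-1≢ 1<n c c+1<d n-1≡c = 0≢1+n (begin
      0                   ≡⟨ n∣m⇒m%n≡0 n d d∣n ⟨
      n % d               ≡⟨ cong (_% d) (m∸n+n≡m (<⇒≤ 1<n)) ⟨
      (n ∸ 1 + 1) % d     ≡⟨ +-cong-% d n-1≡c refl ⟩
      (c + 1) % d         ≡⟨ cong (_% d) (+-comm c 1) ⟩
      suc c % d           ≡⟨ m<n⇒m%n≡m c+1<d ⟩
      suc c               ∎)

    -- For d ≥ 3, subsets b ∈ H ⊆ S d 0 and ab ∈ K ⊆ S d 1 do not permute:
    -- b · ab = a^(n-1), while a rotation in KH has index ≡ 0 + 0 or ≡ 1 - 0 (mod d).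
    S-nonPermute : 3 ≤ d → ∀ {H K} → H ⊆ S d 0 → K ⊆ S d 1 → (proj₁ e , true) ∈ H → (1 mod n , true) ∈ K → ¬ ProdSub H K
    S-nonPermute 3≤d {H} {K} H⊆ K⊆ b∈H ab∈K HK⊆KH = noFactorisation (HK⊆KH b ab b∈H ab∈K)
      where
      b ab : Elem
      b = (proj₁ e , true)
      ab = (1 mod n , true)
      1<n : 1 < n
      1<n = ≤-trans (s≤s (s≤s z≤n)) (≤-trans 3≤d (∣⇒≤ d∣n))
      rot : ∀ y i → (y , false) ∈ S d i → toℕ y % d ≡ 0 % d
      rot y i p = trans (rot∈S⁻ d i y p) (sym (0%≡0 d))
      noFactorisation : Σ Elem (λ k → Σ Elem λ h → k ∈ K × h ∈ H × b · ab ≡ k · h) → ⊥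
      noFactorisation ((y , false) , (x , false) , y∈ , x∈ , eq) = n-1≢ 1<n 0 (≤-trans (s≤s (s≤s z≤n)) 3≤d) (begin
        (n ∸ 1) % d                      ≡⟨ index-b·ab 1<n ⟨
        toℕ (proj₁ (b · ab)) % d         ≡⟨ cong (_% d) (index-≡ eq) ⟩
        toℕ ((toℕ y + toℕ x) mod n) % d  ≡⟨ toℕ-mod-% _ ⟩
        (toℕ y + toℕ x) % d              ≡⟨ +-cong-% d (rot y 1 (K⊆ (y , false) y∈)) (rot x 0 (H⊆ (x , false) x∈)) ⟩
        0 % d                            ∎)
      noFactorisation ((y , true) , (x , true) , y∈ , x∈ , eq) = n-1≢ 1<n 1 3≤d (begin
        (n ∸ 1) % d                            ≡⟨ index-b·ab 1<n ⟨
        toℕ (proj₁ (b · ab)) % d               ≡⟨ cong (_% d) (index-≡ eq) ⟩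
        toℕ ((toℕ y + (n ∸ toℕ x)) mod n) % d  ≡⟨ toℕ-mod-% _ ⟩
        (toℕ y + (n ∸ toℕ x)) % d              ≡⟨ +-cong-% d (ref∈S⁻ d 1 y (K⊆ (y , true) y∈)) (neg-%0 x x≡0) ⟩
        (1 + 0) % d                            ∎)
        where
        x≡0 : toℕ x % d ≡ 0
        x≡0 = trans (ref∈S⁻ d 0 x (H⊆ (x , true) x∈)) (0%≡0 d)
      noFactorisation ((y , false) , (x , true) , _ , _ , eq) = kind-≢ eq
      noFactorisation ((y , true) , (x , false) , _ , _ , eq) = kind-≢ eq

    S-d≢S-n : d < n → ∀ i → S d i ≢ S n i
    S-d≢S-n d<n i = separated (d mod n , false) (rot∈S⁺ d i _ (trans (toℕ-mod-% d) (n%n≡0 d))) aᵈ∉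
      where
      aᵈ∉ : ¬ (d mod n , false) ∈ S n i
      aᵈ∉ p = ≢-nonZero⁻¹ d (begin
        d                     ≡⟨ m<n⇒m%n≡m d<n ⟨
        d % n                 ≡⟨ toℕ-mod d ⟨
        toℕ (d mod n)         ≡⟨ toℕ%n (d mod n) ⟨
        toℕ (d mod n) % n     ≡⟨ rot∈S⁻ n i _ p ⟩
        0                     ∎)

  S-0≢S-1 : ∀ d₁ .{{_ : NonZero d₁}} d₂ .{{_ : NonZero d₂}} → 2 ≤ d₂ → S d₁ 0 ≢ S d₂ 1
  S-0≢S-1 d₁ d₂ 2≤d₂ = separated (proj₁ e , true) (b∈S d₁) b∉
    where
    b∉ : ¬ (proj₁ e , true) ∈ S d₂ 1
    b∉ p = 0≢1+n (begin
      0                      ≡⟨ 0%≡0 d₂ ⟨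
      0 % d₂                 ≡⟨ cong (_% d₂) toℕ-e ⟨
      toℕ (proj₁ e) % d₂     ≡⟨ ref∈S⁻ d₂ 1 _ p ⟩
      1 % d₂                 ≡⟨ m<n⇒m%n≡m 2≤d₂ ⟩
      1                      ∎)

  ⟨a^_b⟩ : Fin n → Sub
  ⟨a^ i b⟩ = S n (toℕ i)

  ⟨a^b⟩-vertex : 2 ≤ n → ∀ i → Vertex ⟨a^ i b⟩
  ⟨a^b⟩-vertex 2≤n i = Divisor.S-vertex n ∣-refl 2≤n (toℕ i)

  ref∈⟨a^b⟩ : ∀ i → (i , true) ∈ ⟨a^ i b⟩
  ref∈⟨a^b⟩ i = ref∈S⁺ n (toℕ i) i refl

  ⟨a^b⟩-members : ∀ i x → x ∈ ⟨a^ i b⟩ → x ≡ e ⊎ x ≡ (i , true)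
  ⟨a^b⟩-members i (a , false) p = inj₁ (cong (_, false) (toℕ-injective (begin
    toℕ a          ≡⟨ toℕ%n a ⟨
    toℕ a % n      ≡⟨ rot∈S⁻ n (toℕ i) a p ⟩
    0              ≡⟨ toℕ-e ⟨
    toℕ (proj₁ e)  ∎)))
  ⟨a^b⟩-members i (a , true) p = inj₂ (cong (_, true) (toℕ-injective (begin
    toℕ a          ≡⟨ toℕ%n a ⟨
    toℕ a % n      ≡⟨ ref∈S⁻ n (toℕ i) a p ⟩
    toℕ i % n      ≡⟨ toℕ%n i ⟩
    toℕ i          ∎)))

  ⟨a^b⟩-commute : ∀ i j → (i , true) · (j , true) ≡ (j , true) · (i , true) →
    ∀ h k → h ∈ ⟨a^ i b⟩ → k ∈ ⟨a^ j b⟩ → h · k ≡ k · h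
  ⟨a^b⟩-commute i j ij≡ji h k h∈ k∈ with ⟨a^b⟩-members i h h∈ | ⟨a^b⟩-members j k k∈
  ... | inj₁ refl | inj₁ refl = refl
  ... | inj₁ refl | inj₂ refl = trans (e·x k) (sym (x·e k))
  ... | inj₂ refl | inj₁ refl = trans (x·e h) (sym (e·x h))
  ... | inj₂ refl | inj₂ refl = ij≡ji

  reflectionPair : ∀ i j → Permute ⟨a^ i b⟩ ⟨a^ j b⟩ →
    δ (toℕ i) (toℕ j) ≡ 0 ⊎ δ (toℕ i) (toℕ j) ≡ δ (toℕ j) (toℕ i)
  reflectionPair i j (HK⊆KH , _) with HK⊆KH (i , true) (j , true) (ref∈⟨a^b⟩ i) (ref∈⟨a^b⟩ j)
  ... | k , h , k∈ , h∈ , eq with ⟨a^b⟩-members j k k∈ | ⟨a^b⟩-members i h h∈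
  ... | inj₁ refl | inj₁ refl = inj₁ (begin
        δ (toℕ i) (toℕ j)                     ≡⟨ index-ref·ref i j ⟨
        toℕ (proj₁ ((i , true) · (j , true))) ≡⟨ index-≡ eq ⟩
        toℕ (proj₁ (e · e))                   ≡⟨ index-≡ (e·x e) ⟩
        toℕ (proj₁ e)                         ≡⟨ toℕ-e ⟩
        0                                     ∎)
  ... | inj₂ refl | inj₂ refl = inj₂ (begin
        δ (toℕ i) (toℕ j)                     ≡⟨ index-ref·ref i j ⟨
        toℕ (proj₁ ((i , true) · (j , true))) ≡⟨ index-≡ eq ⟩
        toℕ (proj₁ ((j , true) · (i , true))) ≡⟨ index-ref·ref j i ⟩
        δ (toℕ j) (toℕ i)                     ∎)
  ... | inj₁ refl | inj₂ refl = ⊥-elim (kind-≢ eq)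
  ... | inj₂ refl | inj₁ refl = ⊥-elim (kind-≢ eq)

  powers : ∀ {H} → IsSubgroup H → ∀ x → (x , false) ∈ H → ∀ k → ((k * toℕ x) mod n , false) ∈ H
  powers sH x x∈ zero = IsSubgroup.has-e sH
  powers {H} sH x x∈ (suc k) = subst (_∈ H) x·xᵏ≡xᵏ⁺¹ (IsSubgroup.closed· sH (x , false) ((k * toℕ x) mod n , false) x∈ (powers sH x x∈ k))
    where
    x·xᵏ≡xᵏ⁺¹ : (x , false) · ((k * toℕ x) mod n , false) ≡ ((suc k * toℕ x) mod n , false)
    x·xᵏ≡xᵏ⁺¹ = cong (_, false) (mod-≡ (trans
      (+-cong-% n refl (trans (cong (_% n) (toℕ-mod (k * toℕ x))) (m%n%n≡m%n (k * toℕ x) n)))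
      (sym (toℕ-mod _))))

  a-generates : ∀ {H} → IsSubgroup H → (1 mod n , false) ∈ H → ∀ y → (y , false) ∈ H
  a-generates {H} sH a∈ y = subst (λ w → (w , false) ∈ H) (mod-≡ (begin
    (toℕ y * toℕ (1 mod n)) % n    ≡⟨ cong (λ u → (toℕ y * u) % n) (toℕ-mod 1) ⟩
    (toℕ y * (1 % n)) % n          ≡⟨ %-distribˡ-* (toℕ y) (1 % n) n ⟩
    (toℕ y % n * (1 % n % n)) % n  ≡⟨ cong (λ u → (toℕ y % n * u) % n) (m%n%n≡m%n 1 n) ⟩
    (toℕ y % n * (1 % n)) % n      ≡⟨ %-distribˡ-* (toℕ y) 1 n ⟨
    (toℕ y * 1) % n                ≡⟨ cong (_% n) (*-identityʳ (toℕ y)) ⟩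
    toℕ y % n                      ≡⟨ toℕ%n y ⟩
    toℕ y                          ∎)) (powers sH (1 mod n) a∈ (toℕ y))

  -- a rotation a^x with x coprime to n generates a: by Bézout, a power of a^x is a or a⁻¹
  coprime⇒a∈ : ∀ {H} → IsSubgroup H → ∀ x → (x , false) ∈ H → Coprime n (toℕ x) → (1 mod n , false) ∈ H
  coprime⇒a∈ {H} sH x x∈ coprime with coprime-Bézout coprime
  ... | Bézout.-+ u v 1+un≡vx = subst (λ w → (w , false) ∈ H) (mod-≡ (begin
        (v * toℕ x) % n      ≡⟨ cong (_% n) 1+un≡vx ⟨
        (1 + u * n) % n      ≡⟨ [m+kn]%n≡m%n 1 u n ⟩
        1 % n                ≡⟨ toℕ-mod 1 ⟨
        toℕ (1 mod n)        ∎)) (powers sH x x∈ v)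
  ... | Bézout.+- u v 1+vx≡un = subst (λ w → (w , false) ∈ H) (mod-≡ (begin
        (n ∸ toℕ ((v * toℕ x) mod n)) % n ≡⟨ cong (λ w → (n ∸ w) % n) vx≡n-1 ⟩
        (n ∸ (n ∸ 1)) % n                ≡⟨ cong (_% n) (m∸[m∸n]≡n (>-nonZero⁻¹ n)) ⟩
        1 % n                            ≡⟨ toℕ-mod 1 ⟨
        toℕ (1 mod n)                    ∎)) (IsSubgroup.closed⁻ sH ((v * toℕ x) mod n , false) (powers sH x x∈ v))
    where
    vx≡n-1 : toℕ ((v * toℕ x) mod n) ≡ n ∸ 1
    vx≡n-1 = trans (toℕ-mod _) (%-pred-≡0 (trans (cong (_% n) 1+vx≡un) (m*n%n≡0 u n)))

  rotations+reflection⇒full : ∀ {H} → IsSubgroup H → (∀ y → (y , false) ∈ H) → ∀ i → (i , true) ∈ H → H ≡ fullSub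
  rotations+reflection⇒full {H} sH rotations i i∈ = ⊆-antisym (λ y _ → ∈full y) everything
    where
    -- a^y b = a^(y - i) · a^i b
    reflection : ∀ y → (y , true) ∈ H
    reflection y = subst (_∈ H) (cong (_, true) (mod-≡ (begin
      (toℕ ((toℕ y + (n ∸ toℕ i)) mod n) + toℕ i) % n ≡⟨ cong (λ u → (u + toℕ i) % n) (toℕ-mod _) ⟩
      (δ (toℕ y) (toℕ i) + toℕ i) % n                ≡⟨ δ-+ (toℕ y) (<⇒≤ (toℕ<n i)) ⟩
      toℕ y % n                                      ≡⟨ toℕ%n y ⟩
      toℕ y                                          ∎)))
      (IsSubgroup.closed· sH (y-i , false) (i , true) (rotations y-i) i∈)
      where
      y-i = (toℕ y + (n ∸ toℕ i)) mod n
    everything : fullSub ⊆ H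
    everything (y , false) _ = rotations y
    everything (y , true)  _ = reflection y

  hasReflection? : (H : Sub) → Dec (∃ λ i → (i , true) ∈ H)
  hasReflection? (R , F) = any? (λ i → T? (lookup F i))

  reflectionFree : Sub → Bool
  reflectionFree H = not (does (hasReflection? H))

  reflectionFree-true : ∀ H → reflectionFree H ≡ true → NoReflection H
  reflectionFree-true H c x x∈ with hasReflection? H
  reflectionFree-true H () x x∈ | yes _
  reflectionFree-true H c  x x∈ | no none = none (x , x∈)

  reflectionFree-false : ∀ H → reflectionFree H ≡ false → ∃ λ i → (i , true) ∈ H
  reflectionFree-false H c with hasReflection? H
  reflectionFree-false H c  | yes reflection = reflection
  reflectionFree-false H () | no _

-- Split ⇒ no divisor 3 ≤ d < n: S d 0 ⊇ S n 0 and S d 1 ⊇ S n 1 form an induced 2K₂.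
module ProperDivisor (n : ℕ) .{{_ : NonZero n}} (d : ℕ) .{{_ : NonZero d}} (d∣n : d ∣ n) (3≤d : 3 ≤ d) (d<n : d < n) where
  open Dihedral n
  open DihedralFacts n
  open SplitGraphs Vertex Permute
  module D = Divisor d d∣n
  module N = Divisor n ∣-refl

  2≤d : 2 ≤ d
  2≤d = ≤-trans (s≤s (s≤s z≤n)) 3≤d

  2≤n : 2 ≤ n
  2≤n = ≤-trans 2≤d (<⇒≤ d<n)

  nested : ∀ i → Edge (S d i) (S n i)
  nested i = D.S-d≢S-n d<n i , ⊆⇒Permute (D.S-subgroup i) (N.S-subgroup i) (D.S-n⊆S-d i)

  apart : ∀ {H K} → H ⊆ S d 0 → K ⊆ S d 1 → (proj₁ e , true) ∈ H → (1 mod n , true) ∈ K → ¬ Permute H K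
  apart H⊆ K⊆ b∈ ab∈ = D.S-nonPermute 3≤d H⊆ K⊆ b∈ ab∈ ∘ proj₁

  ⊆-refl : ∀ {H} → H ⊆ H
  ⊆-refl _ x∈ = x∈

  2K₂ : Induced2K₂
  2K₂ = record
    { x₁ = S d 0 ; y₁ = S n 0 ; x₂ = S d 1 ; y₂ = S n 1
    ; x₁-vertex = D.S-vertex 2≤d 0 ; y₁-vertex = N.S-vertex 2≤n 0
    ; x₂-vertex = D.S-vertex 2≤d 1 ; y₂-vertex = N.S-vertex 2≤n 1
    ; edge₁ = nested 0
    ; edge₂ = nested 1
    ; x₁x₂ = S-0≢S-1 d d 2≤d , apart ⊆-refl ⊆-refl (b∈S d) D.ab∈S
    ; x₁y₂ = S-0≢S-1 d n 2≤n , apart ⊆-refl (D.S-n⊆S-d 1) (b∈S d) N.ab∈S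
    ; y₁x₂ = S-0≢S-1 n d 2≤d , apart (D.S-n⊆S-d 0) ⊆-refl (b∈S n) D.ab∈S
    ; y₁y₂ = S-0≢S-1 n n 2≤n , apart (D.S-n⊆S-d 0) (D.S-n⊆S-d 1) (b∈S n) N.ab∈S
    }

-- Split ⇒ n ≠ 4: {1,b}, {1,a²b} commute (a² is central), as do {1,ab}, {1,a³b},
-- while a^(i-j) ∉ {1 , a^(j-i)} for i - j odd.
module Four where
  open Dihedral 4
  open DihedralFacts 4
  open SplitGraphs Vertex Permute

  central : ∀ i j → (i , true) · (j , true) ≡ (j , true) · (i , true) → ¬ (i , true) ∈ ⟨a^ j b⟩ → Edge ⟨a^ i b⟩ ⟨a^ j b⟩
  central i j ij≡ji i∉ = separated (i , true) (ref∈⟨a^b⟩ i) i∉ , commute⇒Permute (⟨a^b⟩-commute i j ij≡ji)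

  noncentral : ∀ i j → ¬ (δ (toℕ i) (toℕ j) ≡ 0 ⊎ δ (toℕ i) (toℕ j) ≡ δ (toℕ j) (toℕ i)) → ¬ (i , true) ∈ ⟨a^ j b⟩ → NonEdge ⟨a^ i b⟩ ⟨a^ j b⟩
  noncentral i j δ-bad i∉ = separated (i , true) (ref∈⟨a^b⟩ i) i∉ , δ-bad ∘ reflectionPair i j

  vertex : ∀ i → Vertex ⟨a^ i b⟩
  vertex = ⟨a^b⟩-vertex (s≤s (s≤s z≤n))

  2K₂ : Induced2K₂
  2K₂ = record
    { x₁ = ⟨a^ # 0 b⟩ ; y₁ = ⟨a^ # 2 b⟩ ; x₂ = ⟨a^ # 1 b⟩ ; y₂ = ⟨a^ # 3 b⟩
    ; x₁-vertex = vertex (# 0) ; y₁-vertex = vertex (# 2)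
    ; x₂-vertex = vertex (# 1) ; y₂-vertex = vertex (# 3)
    ; edge₁ = central (# 0) (# 2) refl (λ ())
    ; edge₂ = central (# 1) (# 3) refl (λ ())
    ; x₁x₂ = noncentral (# 0) (# 1) (λ { (inj₁ ()) ; (inj₂ ()) }) (λ ())
    ; x₁y₂ = noncentral (# 0) (# 3) (λ { (inj₁ ()) ; (inj₂ ()) }) (λ ())
    ; y₁x₂ = noncentral (# 2) (# 1) (λ { (inj₁ ()) ; (inj₂ ()) }) (λ ())
    ; y₁y₂ = noncentral (# 2) (# 3) (λ { (inj₁ ()) ; (inj₂ ()) }) (λ ())
    }

module OddPrime (n : ℕ) .{{_ : NonZero n}} (n-prime : Prime n) (n-odd : ¬ 2 ∣ n) where
  open Dihedral n
  open DihedralFacts n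
  open SplitGraphs Vertex Permute
  open IsSubgroup

  -- a proper subgroup containing a reflection has no rotation a^x ≠ 1, since
  -- x would be coprime to the prime n and a^x would generate all rotations
  rotation-trivial : ∀ {H} → IsSubgroup H → H ≢ fullSub → ∀ i → (i , true) ∈ H → ∀ x → (x , false) ∈ H → toℕ x ≡ 0
  rotation-trivial sH H≢full i i∈ x x∈ with toℕ x ≟ 0
  ... | yes x≡0 = x≡0
  ... | no x≢0 = contradiction (rotations+reflection⇒full sH (a-generates sH a∈) i i∈) H≢full
    where
    a∈ = coprime⇒a∈ sH x x∈ (prime⇒coprime n-prime {{≢-nonZero x≢0}} (toℕ<n x))

  -- ... and at most one reflection, as a^i b · a^j b = a^(i-j)
  reflection-unique : ∀ {H} → IsSubgroup H → H ≢ fullSub → ∀ i j → (i , true) ∈ H → (j , true) ∈ H → i ≡ j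
  reflection-unique sH H≢full i j i∈ j∈ = toℕ-injective (δ≡0⇒≡ (toℕ<n i) (toℕ<n j) (begin
    δ (toℕ i) (toℕ j)                     ≡⟨ index-ref·ref i j ⟨
    toℕ (proj₁ ((i , true) · (j , true))) ≡⟨ rotation-trivial sH H≢full i i∈ _ (closed· sH (i , true) (j , true) i∈ j∈) ⟩
    0                                     ∎))

  proper⇒⟨a^b⟩ : ∀ {H} → Vertex H → ∀ i → (i , true) ∈ H → H ≡ ⟨a^ i b⟩
  proper⇒⟨a^b⟩ {H} (sH , _ , H≢full) i i∈ = ⊆-antisym H⊆ ⊆H
    where
    H⊆ : H ⊆ ⟨a^ i b⟩
    H⊆ (x , false) x∈ = rot∈S⁺ n (toℕ i) x (trans (cong (_% n) (rotation-trivial sH H≢full i i∈ x x∈)) (0%≡0 n))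
    H⊆ (x , true)  x∈ = subst (λ y → (y , true) ∈ ⟨a^ i b⟩) (reflection-unique sH H≢full i x i∈ x∈) (ref∈⟨a^b⟩ i)
    ⊆H : ⟨a^ i b⟩ ⊆ H
    ⊆H x x∈ with ⟨a^b⟩-members i x x∈
    ... | inj₁ refl = has-e sH
    ... | inj₂ refl = i∈

  reflections-nonPermute : ∀ {H K} → Vertex H → Vertex K → H ≢ K → ∀ i j → (i , true) ∈ H → (j , true) ∈ K → ¬ Permute H K
  reflections-nonPermute vH vK H≢K i j i∈ j∈ perm with proper⇒⟨a^b⟩ vH i i∈ | proper⇒⟨a^b⟩ vK j j∈
  ... | refl | refl = H≢K (cong ⟨a^_b⟩ (toℕ-injective (same (reflectionPair i j perm))))
    where
    same : δ (toℕ i) (toℕ j) ≡ 0 ⊎ δ (toℕ i) (toℕ j) ≡ δ (toℕ j) (toℕ i) → toℕ i ≡ toℕ j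
    same (inj₁ δ≡0)  = δ≡0⇒≡ (toℕ<n i) (toℕ<n j) δ≡0
    same (inj₂ δ-sym) = δ-sym⇒≡ n-odd (toℕ<n i) (toℕ<n j) δ-sym

  split : IsSplitΓ
  split = reflectionFree , λ H K vH vK H≢K →
      (λ cH cK → rotations-Permute (reflectionFree-true H cH) (reflectionFree-true K cK))
    , (λ cH cK → reflections-nonPermute vH vK H≢K _ _
                   (proj₂ (reflectionFree-false H cH)) (proj₂ (reflectionFree-false K cK)))

split⇒oddPrime : ∀ n .{{_ : NonZero n}} → 3 ≤ n → Dihedral.IsSplitΓ n → Prime n × ¬ 2 ∣ n
split⇒oddPrime n 3≤n (_ , split) = oddPrime-criterion n 3≤n not4 noProperDivisor
  where
  not4 : n ≢ 4
  not4 refl = SplitGraphs.split⇒2K₂-free _ _ split Four.2K₂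
  noProperDivisor : ∀ d → d ∣ n → 3 ≤ d → d < n → ⊥
  noProperDivisor d d∣n 3≤d d<n = SplitGraphs.split⇒2K₂-free _ _ split (ProperDivisor.2K₂ n d d∣n 3≤d d<n)
    where instance _ = >-nonZero (≤-trans (s≤s z≤n) 3≤d)

theorem4p9 : (n : ℕ) .{{_ : NonZero n}} → 3 ≤ n →
    (Dihedral.IsSplitΓ n ⇔ (Prime n × ¬ (2 ∣ n)))
theorem4p9 n 3≤n = mk⇔ (split⇒oddPrime n 3≤n) (λ (n-prime , n-odd) → OddPrime.split n n-prime n-odd)
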